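{- Let $A$, $B$, $C$ be $m\times n$ matrices over $\{ -1,0,1\}$ that are all layered matrices. Then $G_o^k(A,B,C)$ is semi-transitive for every $k\geq 0$.
   Context: For an $m\times n$ matrix $M=[m_{ij}]$ over $\{ -1,0,1\}$, $G_o(M)$ is the directed graph on $\{1,\dots,n+m\}$ with edges $j\to i$ for all $1\le j<i\le n$, and for $1\le p\le m$, $1\le j\le n$: an edge $j\to n+p$ if $m_{pj}=1$, an edge $n+p\to j$ if $m_{pj}=-1$, no edge if $m_{pj}=0$; no edges among $n+1,\dots,n+m$. A directed graph is semi-transitive if it is acyclic and for every directed path $u_1\to\cdots\to u_t$, $t\ge2$, either there is no edge $u_1\to u_t$ or all edges $u_i\to u_j$ ($1\le i<j\le t$) exist. For $m\times n$ matrices $A,B,C$ over $\{ -1,0,1\}$, the morphism $\varphi$ replaces each entry $0,1,-1$ by the block $A,B,C$ respectively; $M^k(A,B,C)=\varphi^k([0])$ (with $M^0=[0]$) and $G_o^k(A,B,C)=G_o(M^k(A,B,C))$. A matrix is layered if all entries in the same row are identical. -}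

module Defs where

open import Data.Nat using (ℕ; zero; suc; _*_; _+_; _^_; _≥_; _<_)
open import Data.Fin using (Fin; toℕ; remQuot; splitAt)
open import Data.Product using (_×_; _,_; Σ; ∃)
open import Data.Sum using (_⊎_; inj₁; inj₂)
open import Data.List using (List; []; _∷_; length)
open import Data.List.Relation.Unary.All using (All)
open import Data.Unit using (⊤)
open import Data.Empty using (⊥)
open import Relation.Binary.PropositionalEquality using (_≡_)
open import Relation.Nullary using (¬_)

data Entry : Set where
  neg zer pos : Entry

Matrix : ℕ → ℕ → Set
Matrix m n = Fin m → Fin n → Entry

Layered : ∀ {m n} → Matrix m n → Set
Layered {m} {n} M = ∀ (p : Fin m) (j j′ : Fin n) → M p j ≡ M p j′

-- The morphism φ: each entry 0,1,-1 replaced by the block A,B,C respectively.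
-- Entry (P , J) of φ(M) with P = i*m + p, J = j*n + q  is  (block for M i j) p q.
block : ∀ {m n} → Matrix m n → Matrix m n → Matrix m n → Entry → Matrix m n
block A B C zer = A
block A B C pos = B
block A B C neg = C

φ : ∀ {m n a b} → Matrix m n → Matrix m n → Matrix m n →
    Matrix a b → Matrix (a * m) (b * n)
φ {m} {n} A B C M P J with remQuot m P | remQuot n J
... | i , p | j , q = block A B C (M i j) p q

-- size of M^k: pw m k = m^k, with pw m (suc k) = pw m k * m to match φ
pw : ℕ → ℕ → ℕ
pw m zero    = 1
pw m (suc k) = pw m k * m

Mk : ∀ {m n} → Matrix m n → Matrix m n → Matrix m n →
     (k : ℕ) → Matrix (pw m k) (pw n k)
Mk A B C zero    = λ _ _ → zer
Mk A B C (suc k) = φ A B C (Mk A B C k)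

-- The directed graph G_o(M) for an m × n matrix M, on vertex set Fin (n + m):
-- vertices 0..n-1 correspond to 1..n, vertex n+p to n+1+p.
Edge : ∀ {m n} → Matrix m n → Fin (n + m) → Fin (n + m) → Set
Edge {m} {n} M u v with splitAt n u | splitAt n v
... | inj₁ j | inj₁ i = toℕ j < toℕ i
... | inj₁ j | inj₂ p = M p j ≡ pos
... | inj₂ p | inj₁ j = M p j ≡ neg
... | inj₂ _ | inj₂ _ = ⊥

module _ {V : Set} (E : V → V → Set) where

  IsPath : List V → Set
  IsPath []           = ⊤
  IsPath (x ∷ [])     = ⊤
  IsPath (x ∷ y ∷ xs) = E x y × IsPath (y ∷ xs)

  AllForward : List V → Set
  AllForward []       = ⊤
  AllForward (x ∷ xs) = All (E x) xs × AllForward xs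

  Acyclic : Set
  Acyclic = ∀ (u : V) (us : List V) → IsPath (u ∷ us ++′ (u ∷ [])) → ⊥
    where
    open import Data.List using () renaming (_++_ to _++′_)

  SemiTransitive : Set
  SemiTransitive =
    Acyclic ×
    (∀ (u₁ : V) (us : List V) (ut : V) →
       IsPath (u₁ ∷ us ++′ (ut ∷ [])) →
       E u₁ ut → AllForward (u₁ ∷ us ++′ (ut ∷ [])))
    where
    open import Data.List using () renaming (_++_ to _++′_)

Go : ∀ {m n} → Matrix m n → Fin (n + m) → Fin (n + m) → Set
Go M = Edge M

Gok : ∀ {m n} → Matrix m n → Matrix m n → Matrix m n →
      (k : ℕ) → Fin (pw n k + pw m k) → Fin (pw n k + pw m k) → Set
Gok A B C k = Go (Mk A B C k)

-- In G_o(M) for a layered M every row vertex n+p is a source (row of -1s), a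
-- sink (row of 1s) or isolated, and the column vertices form a transitive
-- tournament. Hence x → y → z forces x → z unless x is a source and z a sink.
-- Along a path u₁ → ⋯ → u_t a source can only be u₁ and a sink only u_t, so
-- every pair u_i, u_j with (i, j) ≠ (1, t) is an edge, and (1, t) is one
-- whenever the shortcut u₁ → u_t exists. Layeredness is inherited by every
-- M^k since φ replaces a constant row by a row of blocks of equal layered matrices.
module Submission where

open import Defs
open import Data.Nat using (ℕ; _+_; zero; suc)
open import Data.Nat.Properties using (<-trans; <-irrefl)
open import Data.Fin using (Fin; splitAt)
open import Data.Product using (_×_; _,_)
open import Data.Sum using (_⊎_; inj₁; inj₂)
open import Data.List using ([]; _∷_; _++_)
open import Data.List.Relation.Unary.All as All using (All; []; _∷_)
open import Data.List.Relation.Unary.All.Properties using (++⁺; ++⁻ˡ; ++⁻ʳ)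
open import Data.Unit using (tt)
open import Data.Empty using (⊥; ⊥-elim)
open import Relation.Binary.PropositionalEquality using (_≡_; _≢_; refl; sym; trans; cong)
open import Relation.Nullary using (¬_)

module SourceSinkTransitive
  {V : Set} (E : V → V → Set) (Source Sink : V → Set)
  (source-no-in : ∀ {x y} → E x y → ¬ Source y)
  (sink-no-out : ∀ {x y} → E x y → ¬ Sink x)
  (irreflexive : ∀ {x} → ¬ E x x)
  (transitive-or-source-sink : ∀ {x y z} → E x y → E y z → E x z ⊎ (Source x × Sink z))
  where

  Reach : V → V → Set
  Reach x y = E x y ⊎ (Source x × Sink y)

  reach-step : ∀ {x y z} → Reach x y → E y z → Reach x z
  reach-step (inj₁ exy) eyz = transitive-or-source-sink exy eyz
  reach-step (inj₂ (_ , sink-y)) eyz = ⊥-elim (sink-no-out eyz sink-y)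

  reach-along : ∀ {x y ys} → Reach x y → IsPath E (y ∷ ys) → All (Reach x) (y ∷ ys)
  reach-along {ys = []} r _ = r ∷ []
  reach-along {ys = z ∷ zs} r (eyz , p) = r ∷ reach-along (reach-step r eyz) p

  path-reach : ∀ {x} ys → IsPath E (x ∷ ys) → All (Reach x) ys
  path-reach [] _ = []
  path-reach (y ∷ ys) (e , p) = reach-along (inj₁ e) p

  reach-from-non-source : ∀ {x y} → ¬ Source x → Reach x y → E x y
  reach-from-non-source _ (inj₁ e) = e
  reach-from-non-source ¬src (inj₂ (src , _)) = ⊥-elim (¬src src)

  reach-to-non-sink : ∀ {x y} → ¬ Sink y → Reach x y → E x y
  reach-to-non-sink _ (inj₁ e) = e
  reach-to-non-sink ¬snk (inj₂ (_ , snk)) = ⊥-elim (¬snk snk)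

  allForward-from-non-source : ∀ {x} xs → ¬ Source x → IsPath E (x ∷ xs) →
                               AllForward E (x ∷ xs)
  allForward-after : ∀ {x} xs → IsPath E (x ∷ xs) → AllForward E xs

  allForward-from-non-source xs ¬src p =
    All.map (reach-from-non-source ¬src) (path-reach xs p) , allForward-after xs p

  allForward-after [] _ = tt
  allForward-after (y ∷ ys) (e , p) = allForward-from-non-source ys (source-no-in e) p

  non-last-not-sink : ∀ x us z → IsPath E (x ∷ us ++ z ∷ []) → All (λ y → ¬ Sink y) (x ∷ us)
  non-last-not-sink x [] z (e , _) = sink-no-out e ∷ []
  non-last-not-sink x (y ∷ us) z (e , p) = sink-no-out e ∷ non-last-not-sink y us z p

  acyclic : Acyclic E
  acyclic u us p with All.head (++⁻ʳ us (path-reach (us ++ u ∷ []) p))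
  ... | inj₁ euu = irreflexive euu
  ... | inj₂ (_ , sink-u) = All.head (non-last-not-sink u us u p) sink-u

  shortcut-allForward : ∀ u₁ us ut → IsPath E (u₁ ∷ us ++ ut ∷ []) → E u₁ ut →
                        AllForward E (u₁ ∷ us ++ ut ∷ [])
  shortcut-allForward u₁ us ut p e₁ₜ = from-u₁ , allForward-after (us ++ ut ∷ []) p
    where
    from-u₁ : All (E u₁) (us ++ ut ∷ [])
    from-u₁ = ++⁺ (All.zipWith (λ (¬snk , r) → reach-to-non-sink ¬snk r)
                               ( All.tail (non-last-not-sink u₁ us ut p)
                               , ++⁻ˡ us (path-reach (us ++ ut ∷ []) p)))
                  (e₁ₜ ∷ [])

  semiTransitive : SemiTransitive E
  semiTransitive = acyclic , shortcut-allForward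

pos≢neg : pos ≢ neg
pos≢neg ()

module _ {m n : ℕ} (M : Matrix m n) (layered : Layered M) where

  SourceRow SinkRow : Fin n ⊎ Fin m → Set
  SourceRow (inj₁ _) = ⊥
  SourceRow (inj₂ p) = ∀ j → M p j ≡ neg
  SinkRow (inj₁ _) = ⊥
  SinkRow (inj₂ p) = ∀ j → M p j ≡ pos

  IsSource IsSink : Fin (n + m) → Set
  IsSource v = SourceRow (splitAt n v)
  IsSink v = SinkRow (splitAt n v)

  private
    source-no-in : ∀ {x y} → Edge M x y → ¬ IsSource y
    source-no-in {x} {y} e src with splitAt n x | splitAt n y
    ... | inj₁ j | inj₁ i = src
    ... | inj₁ j | inj₂ p = pos≢neg (trans (sym e) (src j))
    ... | inj₂ p | inj₁ j = src
    ... | inj₂ _ | inj₂ _ = e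

    sink-no-out : ∀ {x y} → Edge M x y → ¬ IsSink x
    sink-no-out {x} {y} e snk with splitAt n x | splitAt n y
    ... | inj₁ j | inj₁ i = snk
    ... | inj₁ j | inj₂ p = snk
    ... | inj₂ p | inj₁ j = pos≢neg (trans (sym (snk j)) e)
    ... | inj₂ _ | inj₂ _ = e

    irreflexive : ∀ {x} → ¬ Edge M x x
    irreflexive {x} e with splitAt n x
    ... | inj₁ j = <-irrefl refl e
    ... | inj₂ p = e

    transitive-or-source-sink : ∀ {x y z} → Edge M x y → Edge M y z →
                                Edge M x z ⊎ (IsSource x × IsSink z)
    transitive-or-source-sink {x} {y} {z} e₁ e₂ with splitAt n x | splitAt n y | splitAt n z
    ... | inj₁ i | inj₁ j | inj₁ k = inj₁ (<-trans e₁ e₂)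
    ... | inj₁ i | inj₁ j | inj₂ p = inj₁ (trans (layered p i j) e₂)
    ... | inj₂ p | inj₁ j | inj₁ k = inj₁ (trans (layered p k j) e₁)
    ... | inj₂ p | inj₁ j | inj₂ q =
      inj₂ ((λ j′ → trans (layered p j′ j) e₁) , (λ j′ → trans (layered q j′ j) e₂))
    ... | inj₁ i | inj₂ p | inj₁ k = ⊥-elim (pos≢neg (trans (sym e₁) (trans (layered p i k) e₂)))
    ... | inj₁ i | inj₂ p | inj₂ q = ⊥-elim e₂
    ... | inj₂ p | inj₂ q | _ = ⊥-elim e₁

  layered⇒semiTransitive : SemiTransitive (Go M)
  layered⇒semiTransitive =
    SourceSinkTransitive.semiTransitive (Edge M) IsSource IsSink
      source-no-in sink-no-out irreflexive transitive-or-source-sink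

module _ {m n : ℕ} {A B C : Matrix m n}
         (layered-A : Layered A) (layered-B : Layered B) (layered-C : Layered C) where

  block-layered : ∀ e → Layered (block A B C e)
  block-layered zer = layered-A
  block-layered pos = layered-B
  block-layered neg = layered-C

  φ-layered : ∀ {a b} {M : Matrix a b} → Layered M → Layered (φ A B C M)
  φ-layered {M = M} layered-M P J J′ = blocks-equal _ _ _ _ _ _
    where
    blocks-equal : ∀ i j j′ p q q′ → block A B C (M i j) p q ≡ block A B C (M i j′) p q′
    blocks-equal i j j′ p q q′ =
      trans (cong (λ e → block A B C e p q) (layered-M i j j′)) (block-layered (M i j′) p q q′)

  Mk-layered : ∀ k → Layered (Mk A B C k)
  Mk-layered zero _ _ _ = refl
  Mk-layered (suc k) = φ-layered (Mk-layered k)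

proposition3p4 : ∀ {m n : ℕ} (A B C : Matrix m n) →
    Layered A → Layered B → Layered C →
    ∀ (k : ℕ) → SemiTransitive (Gok A B C k)
proposition3p4 A B C layered-A layered-B layered-C k =
  layered⇒semiTransitive (Mk A B C k) (Mk-layered layered-A layered-B layered-C k)
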